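{- If $G$ and $G'$ are JIS graphs, then their Cartesian product $G \times G'$ is JIS.
   Context: All graphs are finite and simple. The Cartesian product $G \times G'$ has vertex set $V(G) \times V(G')$, with $(x,x')$ adjacent to $(y,y')$ iff either $x = y$ and $x'$ is adjacent to $y'$ in $G'$, or $x' = y'$ and $x$ is adjacent to $y$ in $G$. A graph $G$ is called JIS if there exist a positive integer $n$ and an assignment of an $n$-element set $S_v$ to each vertex $v$ of $G$ such that distinct vertices receive distinct sets, and for distinct vertices $v,w$, $v$ and $w$ are adjacent iff $|S_v \cap S_w| = n-1$ (equivalently, $G$ is isomorphic to an induced subgraph of a Johnson graph). -}

module Defs where

open import Data.Nat using (ℕ; suc; _*_)
open import Data.Fin using (Fin; combine; remQuot)
open import Data.Fin.Properties using (combine-remQuot; remQuot-combine)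
open import Data.Fin.Subset using (Subset; _∩_; ∣_∣)
open import Data.Product using (Σ; _×_; _,_; proj₁; proj₂)
open import Data.Sum using (_⊎_; inj₁; inj₂)
open import Relation.Binary.PropositionalEquality using (_≡_; refl; cong; cong₂; trans)
open import Relation.Nullary using (¬_)
open import Function.Bundles using (_↔_; mk↔ₛ′; Inverse)

record Graph : Set₁ where
  field
    V      : Set
    size   : ℕ
    finite : V ↔ Fin size
    Adj    : V → V → Set
    sym    : ∀ {x y} → Adj x y → Adj y x
    irrefl : ∀ {x} → ¬ Adj x x

open Graph public

ProdAdj : (G H : Graph) → V G × V H → V G × V H → Set
ProdAdj G H (x , x') (y , y') = (x ≡ y × Adj H x' y') ⊎ (x' ≡ y' × Adj G x y)

prodAdj-sym : (G H : Graph) → ∀ {p q} → ProdAdj G H p q → ProdAdj G H q p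
prodAdj-sym G H {x , x'} {.x , y'} (inj₁ (refl , a)) = inj₁ (refl , Graph.sym H a)
prodAdj-sym G H {x , x'} {y , .x'} (inj₂ (refl , a)) = inj₂ (refl , Graph.sym G a)

prodAdj-irrefl : (G H : Graph) → ∀ {p} → ¬ ProdAdj G H p p
prodAdj-irrefl G H {x , x'} (inj₁ (_ , a)) = Graph.irrefl H a
prodAdj-irrefl G H {x , x'} (inj₂ (_ , a)) = Graph.irrefl G a

prodFin : (G H : Graph) → (V G × V H) ↔ Fin (size G * size H)
prodFin G H = mk↔ₛ′ to from to∘from from∘to
  where
  module FG = Inverse (finite G)
  module FH = Inverse (finite H)
  to : V G × V H → Fin (size G * size H)
  to (x , y) = combine (FG.to x) (FH.to y)
  from : Fin (size G * size H) → V G × V H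
  from i = FG.from (proj₁ (remQuot {size G} (size H) i)) , FH.from (proj₂ (remQuot {size G} (size H) i))
  to∘from : ∀ i → to (from i) ≡ i
  to∘from i = trans (cong₂ combine (FG.strictlyInverseˡ _) (FH.strictlyInverseˡ _)) (combine-remQuot {size G} (size H) i)
  from∘to : ∀ p → from (to p) ≡ p
  from∘to (x , y) = trans (cong (λ p → FG.from (proj₁ p) , FH.from (proj₂ p)) (remQuot-combine {size G} {size H} (FG.to x) (FH.to y))) (cong₂ _,_ (FG.strictlyInverseʳ x) (FH.strictlyInverseʳ y))

_□_ : Graph → Graph → Graph
G □ H = record
  { V = V G × V H
  ; size = size G * size H
  ; finite = prodFin G H
  ; Adj = ProdAdj G H
  ; sym = prodAdj-sym G H
  ; irrefl = prodAdj-irrefl G H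
  }

-- JIS: there exist a positive integer n = suc n₀ and n-element sets S_v
-- (subsets of a finite ground set Fin m), distinct for distinct vertices,
-- such that for distinct v, w:  v ~ w  iff  |S_v ∩ S_w| = n - 1 (= n₀).
IsJIS : Graph → Set
IsJIS G = Σ ℕ λ n₀ → Σ ℕ λ m → Σ (V G → Subset m) λ S →
    (∀ v → ∣ S v ∣ ≡ suc n₀)
  × (∀ v w → S v ≡ S w → v ≡ w)
  × (∀ v w → ¬ v ≡ w → (Adj G v w → ∣ S v ∩ S w ∣ ≡ n₀) × (∣ S v ∩ S w ∣ ≡ n₀ → Adj G v w))

module Submission where

-- Let S : V G → Subset m and T : V H → Subset k be JIS
-- labellings with |S v| = a + 1 and |T v'| = b + 1.  Label the product
-- vertex (v , v') by the concatenation  S v ++ T v' : Subset (m + k),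
-- a set of size (a + 1) + (b + 1), so the product's "adjacent" overlap
-- is a + b + 1.  Overlaps add up:
--     |U (v , v') ∩ U (w , w')| = |S v ∩ S w| + |T v' ∩ T w'|,
-- and in a JIS labelling the overlap |S v ∩ S w| is a + 1 when v = w,
-- exactly a when v ~ w, and at most a whenever v ≠ w (distinct sets of
-- equal size share fewer elements than they have).  Hence the sum is
-- a + b + 1 exactly when one coordinate agrees and the other is adjacent,
-- i.e. exactly when the product vertices are adjacent.

open import Defs
open import Data.Nat using (ℕ; suc; pred; _+_; _≤_; s≤s)
open import Data.Nat.Properties
  using (+-suc; +-cancelˡ-≡; +-cancelʳ-≡; +-mono-≤; <-irrefl; <⇒≢; ≤∧≢⇒<; ≤-pred)
open import Data.Bool using (_∧_; true; false)
open import Data.Vec using ([]; _∷_; _++_)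
open import Data.Vec.Properties using (++-injective; zipWith-++)
open import Data.Fin.Subset using (Subset; _∩_; ∣_∣)
open import Data.Fin.Subset.Properties using (∣p∩q∣≤∣p∣; ∣p∩q∣≤∣q∣; ∩-idem)
open import Data.Fin.Properties using (inj⇒≟)
open import Data.Product using (_×_; _,_; proj₁; proj₂)
open import Data.Sum using (inj₁; inj₂)
open import Function.Properties.Inverse using (↔⇒↣)
open import Relation.Binary.Definitions using (DecidableEquality)
open import Relation.Binary.PropositionalEquality
  using (_≡_; _≢_; refl; cong; cong₂; trans; subst; module ≡-Reasoning)
  renaming (sym to ≡-sym)
open import Relation.Nullary using (yes; no; contradiction)

∣p++q∣ : ∀ {m k} (p : Subset m) (q : Subset k) → ∣ p ++ q ∣ ≡ ∣ p ∣ + ∣ q ∣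
∣p++q∣ []            q = refl
∣p++q∣ (true  ∷ p) q = cong suc (∣p++q∣ p q)
∣p++q∣ (false ∷ p) q = ∣p++q∣ p q

∣p++q∩p'++q'∣ : ∀ {m k} (p p' : Subset m) (q q' : Subset k) →
                ∣ (p ++ q) ∩ (p' ++ q') ∣ ≡ ∣ p ∩ p' ∣ + ∣ q ∩ q' ∣
∣p++q∩p'++q'∣ p p' q q' =
  trans (cong ∣_∣ (zipWith-++ _∧_ p q p' q')) (∣p++q∣ (p ∩ p') (q ∩ q'))

∣p∩q∣≡∣p∣≡∣q∣⇒p≡q : ∀ {m} (p q : Subset m) →
                     ∣ p ∩ q ∣ ≡ ∣ p ∣ → ∣ p ∣ ≡ ∣ q ∣ → p ≡ q
∣p∩q∣≡∣p∣≡∣q∣⇒p≡q []          []          _   _   = refl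
∣p∩q∣≡∣p∣≡∣q∣⇒p≡q (true  ∷ p) (true  ∷ q) p∩q≡ p≡q =
  cong (true ∷_) (∣p∩q∣≡∣p∣≡∣q∣⇒p≡q p q (cong pred p∩q≡) (cong pred p≡q))
∣p∩q∣≡∣p∣≡∣q∣⇒p≡q (false ∷ p) (false ∷ q) p∩q≡ p≡q =
  cong (false ∷_) (∣p∩q∣≡∣p∣≡∣q∣⇒p≡q p q p∩q≡ p≡q)
∣p∩q∣≡∣p∣≡∣q∣⇒p≡q (true  ∷ p) (false ∷ q) p∩q≡ _ =
  contradiction (subst (_≤ ∣ p ∣) p∩q≡ (∣p∩q∣≤∣p∣ p q)) (<-irrefl refl)
∣p∩q∣≡∣p∣≡∣q∣⇒p≡q (false ∷ p) (true  ∷ q) p∩q≡ p≡q =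
  contradiction (subst (_≤ ∣ q ∣) (trans p∩q≡ p≡q) (∣p∩q∣≤∣q∣ p q)) (<-irrefl refl)

distinct⇒∣p∩q∣≤ : ∀ {m} n (p q : Subset m) →
                  ∣ p ∣ ≡ suc n → ∣ q ∣ ≡ suc n → p ≢ q → ∣ p ∩ q ∣ ≤ n
distinct⇒∣p∩q∣≤ n p q ∣p∣≡ ∣q∣≡ p≢q = ≤-pred (≤∧≢⇒< ∣p∩q∣≤ ∣p∩q∣≢)
  where
  ∣p∩q∣≤ : ∣ p ∩ q ∣ ≤ suc n
  ∣p∩q∣≤ = subst (∣ p ∩ q ∣ ≤_) ∣p∣≡ (∣p∩q∣≤∣p∣ p q)
  ∣p∩q∣≢ : ∣ p ∩ q ∣ ≢ suc n
  ∣p∩q∣≢ e = p≢q (∣p∩q∣≡∣p∣≡∣q∣⇒p≡q p q (trans e (≡-sym ∣p∣≡)) (trans ∣p∣≡ (≡-sym ∣q∣≡)))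

vertex-≟ : (G : Graph) → DecidableEquality (V G)
vertex-≟ G = inj⇒≟ (↔⇒↣ (finite G))

module Labelling {G : Graph} (J : IsJIS G) where

  n₀ : ℕ
  n₀ = proj₁ J

  ground : ℕ
  ground = proj₁ (proj₂ J)

  S : V G → Subset ground
  S = proj₁ (proj₂ (proj₂ J))

  ∣S∣ : ∀ v → ∣ S v ∣ ≡ suc n₀
  ∣S∣ = proj₁ (proj₂ (proj₂ (proj₂ J)))

  S-injective : ∀ v w → S v ≡ S w → v ≡ w
  S-injective = proj₁ (proj₂ (proj₂ (proj₂ (proj₂ J))))

  private
    S-adjacency : ∀ v w → v ≢ w →
                  (Adj G v w → ∣ S v ∩ S w ∣ ≡ n₀) × (∣ S v ∩ S w ∣ ≡ n₀ → Adj G v w)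
    S-adjacency = proj₂ (proj₂ (proj₂ (proj₂ (proj₂ J))))

  meet : V G → V G → ℕ
  meet v w = ∣ S v ∩ S w ∣

  meet-self : ∀ v → meet v v ≡ suc n₀
  meet-self v = trans (cong ∣_∣ (∩-idem (S v))) (∣S∣ v)

  -- Adjacent vertices are distinct by irreflexivity, so no distinctness
  -- hypothesis is needed here.
  meet-adjacent : ∀ {v w} → Adj G v w → meet v w ≡ n₀
  meet-adjacent {v} {w} v~w =
    proj₁ (S-adjacency v w (λ { refl → irrefl G v~w })) v~w

  adjacent-meet : ∀ {v w} → v ≢ w → meet v w ≡ n₀ → Adj G v w
  adjacent-meet {v} {w} v≢w = proj₂ (S-adjacency v w v≢w)

  meet-distinct : ∀ {v w} → v ≢ w → meet v w ≤ n₀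
  meet-distinct {v} {w} v≢w =
    distinct⇒∣p∩q∣≤ n₀ (S v) (S w) (∣S∣ v) (∣S∣ w) (λ e → v≢w (S-injective v w e))

module Product {G H : Graph} (JG : IsJIS G) (JH : IsJIS H) where

  module L = Labelling {G} JG
  module L' = Labelling {H} JH
  open L using (n₀; S)
  open L' using () renaming (n₀ to n₀'; S to T)

  -- One less than the label size (n₀ + 1) + (n₀' + 1).
  N₀ : ℕ
  N₀ = n₀ + suc n₀'

  U : V G × V H → Subset (L.ground + L'.ground)
  U (v , v') = S v ++ T v'

  ∣U∣ : ∀ p → ∣ U p ∣ ≡ suc N₀
  ∣U∣ (v , v') = trans (∣p++q∣ (S v) (T v')) (cong₂ _+_ (L.∣S∣ v) (L'.∣S∣ v'))

  U-injective : ∀ p q → U p ≡ U q → p ≡ q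
  U-injective (v , v') (w , w') e with ++-injective (S v) (S w) e
  ... | Sv≡Sw , Tv'≡Tw' = cong₂ _,_ (L.S-injective v w Sv≡Sw) (L'.S-injective v' w' Tv'≡Tw')

  meet-U : ∀ v v' w w' → ∣ U (v , v') ∩ U (w , w') ∣ ≡ L.meet v w + L'.meet v' w'
  meet-U v v' w w' = ∣p++q∩p'++q'∣ (S v) (S w) (T v') (T w')

  adjacent⇒meet : ∀ v v' w w' → ProdAdj G H (v , v') (w , w') →
                  L.meet v w + L'.meet v' w' ≡ N₀
  adjacent⇒meet v v' .v w' (inj₁ (refl , v'~w')) =
    trans (cong₂ _+_ (L.meet-self v) (L'.meet-adjacent v'~w')) (≡-sym (+-suc n₀ n₀'))
  adjacent⇒meet v v' w .v' (inj₂ (refl , v~w)) =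
    cong₂ _+_ (L.meet-adjacent v~w) (L'.meet-self v')

  -- Conversely, meet N₀ forces exactly one agreeing coordinate (both
  -- distinct give at most n₀ + n₀' < N₀), and then adjacency in the other.
  meet⇒adjacent : ∀ v v' w w' → (v , v') ≢ (w , w') →
                  L.meet v w + L'.meet v' w' ≡ N₀ → ProdAdj G H (v , v') (w , w')
  meet⇒adjacent v v' w w' p≢q e with vertex-≟ G v w | vertex-≟ H v' w'
  ... | yes refl | yes refl = contradiction refl p≢q
  ... | yes refl | no v'≢w' = inj₁ (refl , L'.adjacent-meet v'≢w' (+-cancelˡ-≡ (suc n₀) _ _ e'))
    where
    open ≡-Reasoning
    e' : suc n₀ + L'.meet v' w' ≡ suc n₀ + n₀'
    e' = begin
      suc n₀ + L'.meet v' w'     ≡⟨ cong (_+ L'.meet v' w') (≡-sym (L.meet-self v)) ⟩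
      L.meet v v + L'.meet v' w' ≡⟨ e ⟩
      n₀ + suc n₀'               ≡⟨ +-suc n₀ n₀' ⟩
      suc n₀ + n₀'               ∎
  ... | no v≢w | yes refl = inj₂ (refl , L.adjacent-meet v≢w (+-cancelʳ-≡ (suc n₀') _ _ e'))
    where
    e' : L.meet v w + suc n₀' ≡ n₀ + suc n₀'
    e' = trans (cong (L.meet v w +_) (≡-sym (L'.meet-self v'))) e
  ... | no v≢w | no v'≢w' =
    contradiction (trans e (+-suc n₀ n₀'))
                  (<⇒≢ (s≤s (+-mono-≤ (L.meet-distinct v≢w) (L'.meet-distinct v'≢w'))))

proposition7 : (G H : Graph) → IsJIS G → IsJIS H → IsJIS (G □ H)
proposition7 G H JG JH = N₀ , _ , U , ∣U∣ , U-injective , adjacency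
  where
  open Product {G} {H} JG JH
  adjacency : ∀ p q → p ≢ q →
              (ProdAdj G H p q → ∣ U p ∩ U q ∣ ≡ N₀) × (∣ U p ∩ U q ∣ ≡ N₀ → ProdAdj G H p q)
  adjacency (v , v') (w , w') p≢q rewrite meet-U v v' w w' =
    adjacent⇒meet v v' w w' , meet⇒adjacent v v' w w' p≢q
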